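{- Let $\mathcal{C}$ be the class of graphs constructed as follows. For every integer $r\ge2$, let $B_r$ be a finite constant and $G_{r,1},G_{r,2},\ldots$ graphs such that for every $m\ge1$: $\omega(G_{r,m})=r$, $\chi(G_{r,m})\ge m$, and every induced subgraph $H$ of $G_{r,m}$ with $\omega(H)\le r-1$ satisfies $\chi(H)\le B_r$. For every $r\ge2$ let $T_r$ be a connected triangle-free graph with $\omega(T_r)=2$ and $\chi(T_r)=r$. Set $X_{r,m}=G_{r,m}\cup T_r$ (disjoint union), $\mathcal{C}_r=\{X_{r,m}:m\ge1\}$ and $\mathcal{C}=\bigcup_{r\ge2}\mathcal{C}_r$. Then $\mathcal{C}$ is Pollyanna.
   Context: All graphs are finite, simple and undirected; $\chi$ denotes chromatic number and $\omega$ clique number. Graph classes need not be hereditary. A class $\mathcal{F}$ is $\chi$-bounded if there is a function $\varphi:\mathbb{N}\to\mathbb{N}$ such that for every $G\in\mathcal{F}$ and every induced subgraph $H$ of $G$, $\chi(H)\le\varphi(\omega(H))$; it is polynomially $\chi$-bounded if such $\varphi$ can be taken to be bounded above by a polynomial. A class $\mathcal{C}$ is Pollyanna if $\mathcal{C}\cap\mathcal{F}$ is polynomially $\chi$-bounded for every $\chi$-bounded class $\mathcal{F}$. -}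

module Defs where

open import Data.Nat using (ℕ; zero; suc; _+_; _*_; _^_; _≤_; _∸_)
open import Data.Fin using (Fin; splitAt; _↑ˡ_; _↑ʳ_)
open import Data.Bool using (Bool; true; false)
open import Data.Sum using (_⊎_; inj₁; inj₂)
open import Data.Product using (Σ; ∃; _×_; _,_)
open import Relation.Binary.PropositionalEquality using (_≡_; _≢_; refl)
open import Relation.Nullary using (¬_)
open import Function.Definitions using (Injective)

record Graph : Set where
  field
    n     : ℕ
    adj   : Fin n → Fin n → Bool
    sym   : ∀ i j → adj i j ≡ adj j i
    irrefl : ∀ i → adj i i ≡ false
open Graph public

HasClique : Graph → ℕ → Set
HasClique G k = Σ (Fin k → Fin (n G)) λ f →
  Injective _≡_ _≡_ f × (∀ i j → i ≢ j → adj G (f i) (f j) ≡ true)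

CliqueNumber : Graph → ℕ → Set
CliqueNumber G w = HasClique G w × ¬ HasClique G (suc w)

Colorable : Graph → ℕ → Set
Colorable G k = Σ (Fin (n G) → Fin k) λ c →
  ∀ i j → adj G i j ≡ true → c i ≢ c j

ChromaticNumber : Graph → ℕ → Set
ChromaticNumber G k = Colorable G k × ¬ Colorable G (k ∸ 1)

ChiAtLeast : Graph → ℕ → Set
ChiAtLeast G m = ¬ Colorable G (m ∸ 1)

data Walk (G : Graph) : Fin (n G) → Fin (n G) → Set where
  here : ∀ {u} → Walk G u u
  step : ∀ {u w v} → adj G u w ≡ true → Walk G w v → Walk G u v

Connected : Graph → Set
Connected G = ∀ u v → Walk G u v

TriangleFree : Graph → Set
TriangleFree G = ¬ HasClique G 3

record InducedSub (G : Graph) : Set where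
  field
    k   : ℕ
    emb : Fin k → Fin (n G)
    inj : Injective _≡_ _≡_ emb

induced : (G : Graph) → InducedSub G → Graph
induced G S = record
  { n = InducedSub.k S
  ; adj = λ i j → adj G (InducedSub.emb S i) (InducedSub.emb S j)
  ; sym = λ i j → sym G (InducedSub.emb S i) (InducedSub.emb S j)
  ; irrefl = λ i → irrefl G (InducedSub.emb S i)
  }

private
  uadj : ∀ {a b} → (Fin a → Fin a → Bool) → (Fin b → Fin b → Bool)
       → Fin a ⊎ Fin b → Fin a ⊎ Fin b → Bool
  uadj A B (inj₁ i) (inj₁ j) = A i j
  uadj A B (inj₂ i) (inj₂ j) = B i j
  uadj A B (inj₁ _) (inj₂ _) = false
  uadj A B (inj₂ _) (inj₁ _) = false

  usym : ∀ {a b} (A : Fin a → Fin a → Bool) (B : Fin b → Fin b → Bool)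
       → (∀ i j → A i j ≡ A j i) → (∀ i j → B i j ≡ B j i)
       → ∀ x y → uadj A B x y ≡ uadj A B y x
  usym A B sA sB (inj₁ i) (inj₁ j) = sA i j
  usym A B sA sB (inj₂ i) (inj₂ j) = sB i j
  usym A B sA sB (inj₁ _) (inj₂ _) = refl
  usym A B sA sB (inj₂ _) (inj₁ _) = refl

  uirr : ∀ {a b} (A : Fin a → Fin a → Bool) (B : Fin b → Fin b → Bool)
       → (∀ i → A i i ≡ false) → (∀ i → B i i ≡ false)
       → ∀ x → uadj A B x x ≡ false
  uirr A B iA iB (inj₁ i) = iA i
  uirr A B iA iB (inj₂ i) = iB i

_∪ᵍ_ : Graph → Graph → Graph
G ∪ᵍ H = record
  { n = n G + n H
  ; adj = λ i j → uadj (adj G) (adj H) (splitAt (n G) i) (splitAt (n G) j)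
  ; sym = λ i j → usym (adj G) (adj H) (sym G) (sym H) (splitAt (n G) i) (splitAt (n G) j)
  ; irrefl = λ i → uirr (adj G) (adj H) (irrefl G) (irrefl H) (splitAt (n G) i)
  }

-- Classes of graphs (not necessarily hereditary) and χ-boundedness.

Class : Set₁
Class = Graph → Set

_∩ᶜ_ : Class → Class → Class
(C ∩ᶜ F) G = C G × F G

ChiBoundedBy : Class → (ℕ → ℕ) → Set
ChiBoundedBy F φ = ∀ G → F G → (S : InducedSub G) → ∀ w →
  CliqueNumber (induced G S) w → Colorable (induced G S) (φ w)

ChiBounded : Class → Set
ChiBounded F = Σ (ℕ → ℕ) λ φ → ChiBoundedBy F φ

PolyBounded : (ℕ → ℕ) → Set
PolyBounded φ = Σ ℕ λ c → Σ ℕ λ d → ∀ x → φ x ≤ c * (suc x) ^ d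

PolyChiBounded : Class → Set
PolyChiBounded F = Σ (ℕ → ℕ) λ φ → PolyBounded φ × ChiBoundedBy F φ

Pollyanna : Class → Set₁
Pollyanna C = (F : Class) → ChiBounded F → PolyChiBounded (C ∩ᶜ F)

GHyp : (ℕ → ℕ) → (ℕ → ℕ → Graph) → Set
GHyp B Gr = ∀ r m → 2 ≤ r → 1 ≤ m →
    CliqueNumber (Gr r m) r
  × ChiAtLeast (Gr r m) m
  × ((S : InducedSub (Gr r m)) → ¬ HasClique (induced (Gr r m) S) r →
       Colorable (induced (Gr r m) S) (B r))

THyp : (ℕ → Graph) → Set
THyp T = ∀ r → 2 ≤ r →
  Connected (T r) × TriangleFree (T r) × CliqueNumber (T r) 2 × ChromaticNumber (T r) r

classC : (ℕ → ℕ → Graph) → (ℕ → Graph) → Class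
classC Gr T X = Σ ℕ λ r → Σ ℕ λ m → 2 ≤ r × 1 ≤ m × X ≡ (Gr r m ∪ᵍ T r)

{-# OPTIONS --safe #-}
-- T_r sits in X_{r,m} as an induced subgraph with ω = 2 and χ = r, so if φ is a
-- χ-binding function for F, every X_{r,m} in F has r ≤ φ(2). As ω(X_{r,m}) = r,
-- every induced subgraph of a member of C ∩ F has clique number w ≤ φ(2) and
-- hence chromatic number at most max_{w ≤ φ(2)} φ(w): a constant, so certainly
-- polynomial, χ-bound.
module Submission where

open import Defs
open import Data.Nat using (ℕ; zero; suc; _+_; _⊔_; _≤_; _≤?_; s≤s; z≤n)
open import Data.Nat.Properties
  using (≤-refl; ≤-trans; ≤-reflexive; ≤-pred; ≰⇒>; m≤n⇒m<n∨m≡n; m≤m⊔n; m≤n⊔m; *-identityʳ)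
open import Data.Fin using (Fin; splitAt; inject≤; _↑ˡ_; _↑ʳ_; _≟_) renaming (zero to fzero; suc to fsuc)
open import Data.Fin.Properties
  using (inject≤-injective; ↑ʳ-injective; splitAt-↑ˡ; splitAt-↑ʳ; splitAt⁻¹-↑ˡ; splitAt⁻¹-↑ʳ)
open import Data.Bool using (true; false)
open import Data.Sum using (_⊎_; inj₁; inj₂)
open import Data.Product using (∃; _,_; proj₁; proj₂)
open import Function using (_∘_; id)
open import Function.Definitions using (Injective)
open import Relation.Binary.PropositionalEquality
  using (_≡_; _≢_; refl; trans; cong₂; subst; module ≡-Reasoning) renaming (sym to ≡-sym)
open import Relation.Nullary using (¬_; yes; no; contradiction)

record Hom (G H : Graph) : Set where
  constructor hom
  field
    map     : Fin (n G) → Fin (n H)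
    map-adj : ∀ x y → adj G x y ≡ true → adj H (map x) (map y) ≡ true

-- Injectivity comes for free: distinct indices go to adjacent, hence distinct, vertices.
clique : ∀ G {k} (f : Fin k → Fin (n G)) →
         (∀ i j → i ≢ j → adj G (f i) (f j) ≡ true) → HasClique G k
clique G f f-adj = f , injective , f-adj
  where
  injective : Injective _≡_ _≡_ f
  injective {i} {j} fi≡fj with i ≟ j
  ... | yes i≡j = i≡j
  ... | no i≢j with () ← trans (≡-sym (irrefl G (f j)))
                              (subst (λ u → adj G u (f j) ≡ true) fi≡fj (f-adj i j i≢j))

HasClique-hom : ∀ {G H k} → Hom G H → HasClique G k → HasClique H k
HasClique-hom {H = H} (hom h h-adj) (f , _ , f-adj) =
  clique H (h ∘ f) λ i j i≢j → h-adj (f i) (f j) (f-adj i j i≢j)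

Colorable-hom : ∀ {G H c} → Hom G H → Colorable H c → Colorable G c
Colorable-hom (hom h h-adj) (col , proper) = col ∘ h , λ x y xy → proper (h x) (h y) (h-adj x y xy)

CliqueNumber-⇄ : ∀ {G H w} → Hom G H → Hom H G → CliqueNumber G w → CliqueNumber H w
CliqueNumber-⇄ G→H H→G (K , ¬K) = HasClique-hom G→H K , ¬K ∘ HasClique-hom H→G

induced-hom : ∀ {G} (S : InducedSub G) → Hom (induced G S) G
induced-hom S = hom (InducedSub.emb S) λ _ _ → id

HasClique-≤ : ∀ G {j k} → j ≤ k → HasClique G k → HasClique G j
HasClique-≤ G j≤k (f , _ , f-adj) =
  clique G (λ i → f (inject≤ i j≤k)) λ i i′ i≢i′ → f-adj _ _ (i≢i′ ∘ inject≤-injective j≤k j≤k i i′)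

Colorable-≤ : ∀ G {a b} → a ≤ b → Colorable G a → Colorable G b
Colorable-≤ G a≤b (col , proper) =
  (λ x → inject≤ (col x) a≤b) , λ x y xy → proper x y xy ∘ inject≤-injective a≤b a≤b _ _

cliqueFree⇒≤ : ∀ G {r w} → ¬ HasClique G (suc r) → HasClique G w → w ≤ r
cliqueFree⇒≤ G {r} {w} ¬K K with w ≤? r
... | yes w≤r = w≤r
... | no w≰r = contradiction (HasClique-≤ G (≰⇒> w≰r) K) ¬K

ChiAtLeast⇒≤ : ∀ G {r c} → ChiAtLeast G r → Colorable G c → r ≤ c
ChiAtLeast⇒≤ G {zero} _ _ = z≤n
ChiAtLeast⇒≤ G {suc r} {c} ¬col col with suc r ≤? c
... | yes r<c = r<c
... | no r≮c = contradiction (Colorable-≤ G (≤-pred (≰⇒> r≮c)) col) ¬col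

record ComponentEmbedding (G X : Graph) : Set where
  field
    embed     : Fin (n G) → Fin (n X)
    adj-embed : ∀ x y → adj X (embed x) (embed y) ≡ adj G x y
    closed    : ∀ x v → adj X (embed x) v ≡ true → ∃ λ y → embed y ≡ v

module _ {G X : Graph} (E : ComponentEmbedding G X) where
  open ComponentEmbedding E

  HasClique-component : ∀ {k x} → ((f , _) : HasClique X (suc k)) → embed x ≡ f fzero →
                        HasClique G (suc k)
  HasClique-component {k} {x} (f , _ , f-adj) ex≡f0 = clique G g g-adj
    where
    preimage : ∀ i → ∃ λ y → embed y ≡ f i
    preimage fzero = x , ex≡f0
    preimage (fsuc i) = closed x (f (fsuc i))
      (subst (λ u → adj X u (f (fsuc i)) ≡ true) (≡-sym ex≡f0) (f-adj fzero (fsuc i) λ ()))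

    g : Fin (suc k) → Fin (n G)
    g = proj₁ ∘ preimage

    g-adj : ∀ i j → i ≢ j → adj G (g i) (g j) ≡ true
    g-adj i j i≢j = begin
      adj G (g i) (g j)                 ≡⟨ ≡-sym (adj-embed (g i) (g j)) ⟩
      adj X (embed (g i)) (embed (g j)) ≡⟨ cong₂ (adj X) (proj₂ (preimage i)) (proj₂ (preimage j)) ⟩
      adj X (f i) (f j)                 ≡⟨ f-adj i j i≢j ⟩
      true                              ∎
      where open ≡-Reasoning

module DisjointUnion (G H : Graph) where

  ↑ˡ-adj : ∀ x y → adj (G ∪ᵍ H) (x ↑ˡ n H) (y ↑ˡ n H) ≡ adj G x y
  ↑ˡ-adj x y rewrite splitAt-↑ˡ (n G) x (n H) | splitAt-↑ˡ (n G) y (n H) = refl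

  ↑ʳ-adj : ∀ x y → adj (G ∪ᵍ H) (n G ↑ʳ x) (n G ↑ʳ y) ≡ adj H x y
  ↑ʳ-adj x y rewrite splitAt-↑ʳ (n G) (n H) x | splitAt-↑ʳ (n G) (n H) y = refl

  ↑ˡ↑ʳ-nonadj : ∀ x y → adj (G ∪ᵍ H) (x ↑ˡ n H) (n G ↑ʳ y) ≡ false
  ↑ˡ↑ʳ-nonadj x y rewrite splitAt-↑ˡ (n G) x (n H) | splitAt-↑ʳ (n G) (n H) y = refl

  data Side (u : Fin (n G + n H)) : Set where
    left  : ∀ x → x ↑ˡ n H ≡ u → Side u
    right : ∀ y → n G ↑ʳ y ≡ u → Side u

  side : ∀ u → Side u
  side u with splitAt (n G) u in eq
  ... | inj₁ x = left x (splitAt⁻¹-↑ˡ eq)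
  ... | inj₂ y = right y (splitAt⁻¹-↑ʳ eq)

  leftComponent : ComponentEmbedding G (G ∪ᵍ H)
  leftComponent = record { embed = _↑ˡ n H ; adj-embed = ↑ˡ-adj ; closed = closed }
    where
    closed : ∀ x v → adj (G ∪ᵍ H) (x ↑ˡ n H) v ≡ true → ∃ λ y → y ↑ˡ n H ≡ v
    closed x v xv with side v
    ... | left y y≡v = y , y≡v
    ... | right y refl with () ← trans (≡-sym xv) (↑ˡ↑ʳ-nonadj x y)

  rightComponent : ComponentEmbedding H (G ∪ᵍ H)
  rightComponent = record { embed = n G ↑ʳ_ ; adj-embed = ↑ʳ-adj ; closed = closed }
    where
    closed : ∀ y v → adj (G ∪ᵍ H) (n G ↑ʳ y) v ≡ true → ∃ λ x → n G ↑ʳ x ≡ v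
    closed y v yv with side v
    ... | right x x≡v = x , x≡v
    ... | left x refl with () ← trans (≡-sym yv)
                                  (trans (sym (G ∪ᵍ H) _ _) (↑ˡ↑ʳ-nonadj x y))

  HasClique-∪ : ∀ {k} → HasClique (G ∪ᵍ H) (suc k) → HasClique G (suc k) ⊎ HasClique H (suc k)
  HasClique-∪ K@(f , _) with side (f fzero)
  ... | left x x≡f0 = inj₁ (HasClique-component leftComponent K x≡f0)
  ... | right y y≡f0 = inj₂ (HasClique-component rightComponent K y≡f0)

  ∪-cliqueFree : ∀ {k} → ¬ HasClique G (suc k) → ¬ HasClique H (suc k) →
                 ¬ HasClique (G ∪ᵍ H) (suc k)
  ∪-cliqueFree ¬K ¬K′ K with HasClique-∪ K
  ... | inj₁ KG = ¬K KG
  ... | inj₂ KH = ¬K′ KH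

  rightPart : InducedSub (G ∪ᵍ H)
  rightPart = record { k = n H ; emb = n G ↑ʳ_ ; inj = ↑ʳ-injective (n G) _ _ }

  rightPart→H : Hom (induced (G ∪ᵍ H) rightPart) H
  rightPart→H = hom id λ x y xy → trans (≡-sym (↑ʳ-adj x y)) xy

  H→rightPart : Hom H (induced (G ∪ᵍ H) rightPart)
  H→rightPart = hom id λ x y xy → trans (↑ʳ-adj x y) xy

open DisjointUnion using (∪-cliqueFree)

ChiBoundedBy-summand : ∀ {F φ G H w} → ChiBoundedBy F φ → F (G ∪ᵍ H) →
                       CliqueNumber H w → Colorable H (φ w)
ChiBoundedBy-summand {G = G} {H} {w} φ-binds X∈F ω[H]≡w =
  Colorable-hom H→rightPart
    (φ-binds _ X∈F rightPart w (CliqueNumber-⇄ H→rightPart rightPart→H ω[H]≡w))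
  where open DisjointUnion G H

maxUpTo : (ℕ → ℕ) → ℕ → ℕ
maxUpTo φ zero = φ zero
maxUpTo φ (suc W) = maxUpTo φ W ⊔ φ (suc W)

≤-maxUpTo : ∀ φ {w W} → w ≤ W → φ w ≤ maxUpTo φ W
≤-maxUpTo φ {W = zero} z≤n = ≤-refl
≤-maxUpTo φ {w} {suc W} w≤1+W with m≤n⇒m<n∨m≡n w≤1+W
... | inj₁ w<1+W = ≤-trans (≤-maxUpTo φ (≤-pred w<1+W)) (m≤m⊔n (maxUpTo φ W) (φ (suc W)))
... | inj₂ refl = m≤n⊔m (maxUpTo φ W) (φ (suc W))

constant-PolyBounded : ∀ K → PolyBounded (λ _ → K)
constant-PolyBounded K = K , 0 , λ _ → ≤-reflexive (≡-sym (*-identityʳ K))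

proposition3p2 : (B : ℕ → ℕ) (Gr : ℕ → ℕ → Graph) (T : ℕ → Graph) →
    GHyp B Gr → THyp T → Pollyanna (classC Gr T)
proposition3p2 B Gr T G-hyp T-hyp F (φ , φ-binds) = (λ _ → K) , constant-PolyBounded K , binds
  where
  K : ℕ
  K = maxUpTo φ (φ 2)

  binds : ChiBoundedBy (classC Gr T ∩ᶜ F) (λ _ → K)
  binds _ ((r , m , 2≤r , 1≤m , refl) , X∈F) S w ω[S]≡w =
    Colorable-≤ (induced _ S) (≤-maxUpTo φ (≤-trans w≤r r≤φ2)) (φ-binds _ X∈F S w ω[S]≡w)
    where
    ω[G]≡r : CliqueNumber (Gr r m) r
    ω[G]≡r = proj₁ (G-hyp r m 2≤r 1≤m)

    triangleFree : TriangleFree (T r)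
    triangleFree = proj₁ (proj₂ (T-hyp r 2≤r))

    ω[T]≡2 : CliqueNumber (T r) 2
    ω[T]≡2 = proj₁ (proj₂ (proj₂ (T-hyp r 2≤r)))

    χ[T]≥r : ChiAtLeast (T r) r
    χ[T]≥r = proj₂ (proj₂ (proj₂ (proj₂ (T-hyp r 2≤r))))

    r≤φ2 : r ≤ φ 2
    r≤φ2 = ChiAtLeast⇒≤ (T r) χ[T]≥r (ChiBoundedBy-summand φ-binds X∈F ω[T]≡2)

    w≤r : w ≤ r
    w≤r = cliqueFree⇒≤ (Gr r m ∪ᵍ T r)
      (∪-cliqueFree (Gr r m) (T r) (proj₂ ω[G]≡r) (triangleFree ∘ HasClique-≤ (T r) (s≤s 2≤r)))
      (HasClique-hom (induced-hom S) (proj₁ ω[S]≡w))
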